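{- Let $G$ be a connected bipartite simple graph with bipartition $(V_1,V_2)$ and edge cone $\mathbb{R}_+\mathcal{A}$, and let $F$ be a facet of $\mathbb{R}_+\mathcal{A}$. If $F=H_A\cap\mathbb{R}_+\mathcal{A}=H_B\cap\mathbb{R}_+\mathcal{A}$ with $A\subsetneq V_1$ and $B\subsetneq V_1$, then $A=B$.
   Context: Let $V(G)=\{v_1,\ldots,v_n\}$ and $e_i$ the $i$-th unit vector of $\mathbb{R}^n$. The edge cone $\mathbb{R}_+\mathcal{A}$ is the cone of nonnegative real combinations of the vectors $e_i+e_j$ with $\{v_i,v_j\}$ an edge of $G$. $N(C)$ is the set of vertices adjacent to some vertex of $C$; for $C\subset V_1$, $H_C=\{x\mid\sum_{v_i\in C}x_i=\sum_{v_i\in N(C)}x_i\}$. A facet of a cone $Q$ is a set $Q\cap H$, $H$ a hyperplane through the origin with $Q$ on one side, of dimension $\dim Q-1$.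
   Formalization: The edge cone, the facet F and the hyperplanes $H_A$, $H_B$ consist of points of ℚ^n rather than ℝ^n, with rational nonnegative coefficients, a rational normal for the facet, and dimensions counted over ℚ. -}

module Defs where

open import Data.Nat using (ℕ; zero; suc)
open import Data.Fin using (Fin; zero; suc; _≟_)
open import Data.Fin.Subset using (Subset)
open import Data.Bool using (Bool; true; false; if_then_else_; _∧_)
open import Data.Vec using (lookup; tabulate)
open import Data.Rational using (ℚ; 0ℚ; 1ℚ; _+_; _*_; _≤_)
open import Data.Product using (Σ; ∃; _×_; _,_)
open import Data.Sum using (_⊎_)
open import Relation.Binary.PropositionalEquality using (_≡_; _≢_)
open import Relation.Nullary using (¬_; does)

Vecℚ : ℕ → Set
Vecℚ n = Fin n → ℚ

Σ[_] : ∀ {n} → (Fin n → ℚ) → ℚ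
Σ[_] {zero}  f = 0ℚ
Σ[_] {suc n} f = f zero + Σ[_] (λ i → f (suc i))

anyFin : ∀ {n} → (Fin n → Bool) → Bool
anyFin {zero}  p = false
anyFin {suc n} p = if p zero then true else anyFin (λ i → p (suc i))

Graph : ℕ → Set
Graph n = Fin n → Fin n → Bool

IsSimple : ∀ {n} → Graph n → Set
IsSimple {n} E = (∀ i j → E i j ≡ E j i) × (∀ i → E i i ≡ false)

data Reach {n} (E : Graph n) : Fin n → Fin n → Set where
  here : ∀ {i} → Reach E i i
  step : ∀ {i j k} → E i j ≡ true → Reach E j k → Reach E i k

IsConnected : ∀ {n} → Graph n → Set
IsConnected {n} E = ∀ (i j : Fin n) → Reach E i j

-- (V1, V2) with V2 = ∁ V1 is a bipartition: every edge joins V1 to V2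
IsBipartition : ∀ {n} → Graph n → Subset n → Set
IsBipartition {n} E V1 = ∀ i j → E i j ≡ true → lookup V1 i ≢ lookup V1 j

N : ∀ {n} → Graph n → Subset n → Subset n
N E C = tabulate (λ j → anyFin (λ i → lookup C i ∧ E i j))

sumOver : ∀ {n} → Subset n → Vecℚ n → ℚ
sumOver S x = Σ[ (λ i → if lookup S i then x i else 0ℚ) ]

H : ∀ {n} → Graph n → Subset n → Vecℚ n → Set
H E C x = sumOver C x ≡ sumOver (N E C) x

δ : ∀ {n} → Fin n → Fin n → ℚ
δ i k = if does (i ≟ k) then 1ℚ else 0ℚ

-- edge cone  ℝ₊𝒜  (over ℚ): nonnegative combinations of e_i + e_j, {v_i,v_j} ∈ E
EdgeCone : ∀ {n} → Graph n → Vecℚ n → Set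
EdgeCone {n} E x =
  ∃ λ (c : Fin n → Fin n → ℚ) →
    (∀ i j → 0ℚ ≤ c i j) ×
    (∀ k → x k ≡ Σ[ (λ i → Σ[ (λ j → if E i j then c i j * (δ i k + δ j k) else 0ℚ) ]) ])

LinIndep : ∀ {n k} → (Fin k → Vecℚ n) → Set
LinIndep {n} {k} u =
  ∀ (c : Fin k → ℚ) → (∀ m → Σ[ (λ i → c i * u i m) ] ≡ 0ℚ) → ∀ i → c i ≡ 0ℚ

HasDim : ∀ {n} → (Vecℚ n → Set) → ℕ → Set
HasDim {n} S d =
  (∃ λ (u : Fin d → Vecℚ n) → (∀ i → S (u i)) × LinIndep u) ×
  (∀ (u : Fin (suc d) → Vecℚ n) → (∀ i → S (u i)) → ¬ LinIndep u)

Hyp : ∀ {n} → Vecℚ n → Vecℚ n → Set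
Hyp a x = Σ[ (λ i → a i * x i) ] ≡ 0ℚ

IsFacet : ∀ {n} → (Vecℚ n → Set) → (Vecℚ n → Set) → Set
IsFacet {n} Q F =
  ∃ λ (a : Vecℚ n) →
    (¬ (∀ i → a i ≡ 0ℚ)) ×
    ((∀ x → Q x → 0ℚ ≤ Σ[ (λ i → a i * x i) ]) ⊎ (∀ x → Q x → Σ[ (λ i → a i * x i) ] ≤ 0ℚ)) ×
    (∀ x → (F x → Q x × Hyp a x) × (Q x × Hyp a x → F x)) ×
    (∃ λ d → HasDim Q (suc d) × HasDim F d)

-- An edge vector e_i + e_j with v_i ∈ V₁ lies in H_S (S ⊆ V₁) exactly when
-- v_i ∈ S ⇔ v_j ∈ N(S), so H_A and H_B cut out the same face of the edge cone
-- only if A and B impose the same condition on every edge. If some vertex lies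
-- in B but not in A, this condition propagates along edges: every vertex of V₁
-- reached lies in B \ A and every vertex of V₂ reached lies in N(B) \ N(A).
-- By connectedness all of V₁ lies in B, contradicting B ⊊ V₁.
module Submission where

open import Defs
open import Algebra.Bundles using (CommutativeMonoid)
open import Data.Bool using (Bool; true; false; if_then_else_; not; _∧_)
open import Data.Bool.Properties using (∧-conicalˡ; ∧-conicalʳ; ¬-not)
open import Data.Fin using (Fin; zero; suc; _≟_)
open import Data.Fin.Properties using (suc-injective)
open import Data.Fin.Subset using (Subset; _⊆_; _⊂_)
open import Data.Fin.Subset.Properties using (⊆-antisym)
open import Data.Integer using (+≤+)
open import Data.Nat using (ℕ; zero; suc; z≤n)
open import Data.Product using (_×_; _,_; proj₁; proj₂; ∃; uncurry)
open import Data.Rational using (ℚ; 0ℚ; 1ℚ; _+_; _*_; _≤_; *≤*)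
open import Data.Rational.Properties
  using (+-identityˡ; +-identityʳ; *-identityˡ; *-zeroˡ; *-zeroʳ; ≤-refl; +-0-commutativeMonoid)
open import Data.Vec using (lookup)
open import Data.Vec.Properties using (lookup∘tabulate; []=⇒lookup; lookup⇒[]=)
open import Function using (_⇔_; mk⇔; Equivalence; _∘_)
open import Relation.Binary.PropositionalEquality
  using (_≡_; _≢_; ≢-sym; refl; sym; trans; cong; cong₂; module ≡-Reasoning)
open import Relation.Nullary using (yes; no; contradiction)

open import Algebra.Properties.CommutativeSemigroup
  (CommutativeMonoid.commutativeSemigroup +-0-commutativeMonoid) using (interchange)
open ≡-Reasoning

Σ-cong : ∀ {n} {f g : Fin n → ℚ} → (∀ i → f i ≡ g i) → Σ[ f ] ≡ Σ[ g ]
Σ-cong {zero}  f≗g = refl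
Σ-cong {suc n} f≗g = cong₂ _+_ (f≗g zero) (Σ-cong (λ i → f≗g (suc i)))

Σ-+ : ∀ {n} (f g : Fin n → ℚ) → Σ[ (λ i → f i + g i) ] ≡ Σ[ f ] + Σ[ g ]
Σ-+ {zero}  f g = sym (+-identityˡ 0ℚ)
Σ-+ {suc n} f g = begin
  (f zero + g zero) + Σ[ (λ i → f (suc i) + g (suc i)) ]
    ≡⟨ cong ((f zero + g zero) +_) (Σ-+ (λ i → f (suc i)) (λ i → g (suc i))) ⟩
  (f zero + g zero) + (Σ[ (λ i → f (suc i)) ] + Σ[ (λ i → g (suc i)) ])
    ≡⟨ interchange (f zero) (g zero) _ _ ⟩
  (f zero + Σ[ (λ i → f (suc i)) ]) + (g zero + Σ[ (λ i → g (suc i)) ]) ∎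

Σ-zero : ∀ {n} {f : Fin n → ℚ} → (∀ i → f i ≡ 0ℚ) → Σ[ f ] ≡ 0ℚ
Σ-zero {zero}  f≗0 = refl
Σ-zero {suc n} f≗0 = trans (cong₂ _+_ (f≗0 zero) (Σ-zero (λ i → f≗0 (suc i)))) (+-identityˡ 0ℚ)

Σ-concentrated : ∀ {n} (f : Fin n → ℚ) (l : Fin n) → (∀ i → i ≢ l → f i ≡ 0ℚ) → Σ[ f ] ≡ f l
Σ-concentrated f zero    f≗0 =
  trans (cong (f zero +_) (Σ-zero (λ i → f≗0 (suc i) λ ()))) (+-identityʳ (f zero))
Σ-concentrated f (suc l) f≗0 =
  trans (cong₂ _+_ (f≗0 zero λ ())
                    (Σ-concentrated (λ i → f (suc i)) l (λ i i≢l → f≗0 (suc i) (i≢l ∘ suc-injective))))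
        (+-identityˡ (f (suc l)))

δ-diag : ∀ {n} (i : Fin n) → δ i i ≡ 1ℚ
δ-diag i with i ≟ i
... | yes _   = refl
... | no i≢i = contradiction refl i≢i

δ-off : ∀ {n} {i k : Fin n} → i ≢ k → δ i k ≡ 0ℚ
δ-off {i = i} {k} i≢k with i ≟ k
... | yes i≡k = contradiction i≡k i≢k
... | no _    = refl

𝟙 : Bool → ℚ
𝟙 true  = 1ℚ
𝟙 false = 0ℚ

𝟙-injective : ∀ {a b} → 𝟙 a ≡ 𝟙 b → a ≡ b
𝟙-injective {true}  {true}  _ = refl
𝟙-injective {false} {false} _ = refl
𝟙-injective {true}  {false} ()
𝟙-injective {false} {true}  ()

sumOver-+ : ∀ {n} (S : Subset n) (x y : Vecℚ n) →
            sumOver S (λ k → x k + y k) ≡ sumOver S x + sumOver S y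
sumOver-+ S x y = trans (Σ-cong restrict-+) (Σ-+ (restrict x) (restrict y))
  where
  restrict : Vecℚ _ → Vecℚ _
  restrict z k = if lookup S k then z k else 0ℚ
  restrict-+ : ∀ k → restrict (λ k → x k + y k) k ≡ restrict x k + restrict y k
  restrict-+ k with lookup S k
  ... | true  = refl
  ... | false = sym (+-identityˡ 0ℚ)

sumOver-δ : ∀ {n} (S : Subset n) (i : Fin n) → sumOver S (δ i) ≡ 𝟙 (lookup S i)
sumOver-δ S i = trans (Σ-concentrated _ i (λ k k≢i → off k (≢-sym k≢i))) diag
  where
  off : ∀ k → i ≢ k → (if lookup S k then δ i k else 0ℚ) ≡ 0ℚ
  off k i≢k with lookup S k
  ... | true  = δ-off i≢k
  ... | false = refl
  diag : (if lookup S i then δ i i else 0ℚ) ≡ 𝟙 (lookup S i)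
  diag with lookup S i
  ... | true  = δ-diag i
  ... | false = refl

edgeVec : ∀ {n} → Fin n → Fin n → Vecℚ n
edgeVec i j k = δ i k + δ j k

sumOver-edgeVec : ∀ {n} (S : Subset n) (i j : Fin n) →
                  sumOver S (edgeVec i j) ≡ 𝟙 (lookup S i) + 𝟙 (lookup S j)
sumOver-edgeVec S i j = trans (sumOver-+ S (δ i) (δ j)) (cong₂ _+_ (sumOver-δ S i) (sumOver-δ S j))

edgeVec∈EdgeCone : ∀ {n} (E : Graph n) {i j : Fin n} → E i j ≡ true → EdgeCone E (edgeVec i j)
edgeVec∈EdgeCone {n} E {i} {j} eᵢⱼ = c , c-nonNeg , λ k → sym (expand k)
  where
  c : Fin n → Fin n → ℚ
  c p q = δ p i * δ q j

  c-nonNeg : ∀ p q → 0ℚ ≤ c p q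
  c-nonNeg p q with p ≟ i | q ≟ j
  ... | yes _ | yes _ = *≤* (+≤+ z≤n)
  ... | yes _ | no _  = ≤-refl
  ... | no _  | yes _ = ≤-refl
  ... | no _  | no _  = ≤-refl

  term : Fin n → Fin n → Fin n → ℚ
  term k p q = if E p q then c p q * edgeVec p q k else 0ℚ

  term-vanishes : ∀ k p q → c p q ≡ 0ℚ → term k p q ≡ 0ℚ
  term-vanishes k p q c≡0 with E p q
  ... | true  = trans (cong (_* edgeVec p q k) c≡0) (*-zeroˡ (edgeVec p q k))
  ... | false = refl

  off-row : ∀ k p → p ≢ i → Σ[ term k p ] ≡ 0ℚ
  off-row k p p≢i = Σ-zero λ q → term-vanishes k p q (trans (cong (_* δ q j) (δ-off p≢i)) (*-zeroˡ (δ q j)))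

  off-column : ∀ k q → q ≢ j → term k i q ≡ 0ℚ
  off-column k q q≢j = term-vanishes k i q (trans (cong (δ i i *_) (δ-off q≢j)) (*-zeroʳ (δ i i)))

  expand : ∀ k → Σ[ (λ p → Σ[ term k p ]) ] ≡ edgeVec i j k
  expand k = begin
    Σ[ (λ p → Σ[ term k p ]) ]    ≡⟨ Σ-concentrated _ i (off-row k) ⟩
    Σ[ term k i ]                 ≡⟨ Σ-concentrated _ j (off-column k) ⟩
    term k i j                    ≡⟨ cong (λ b → if b then c i j * edgeVec i j k else 0ℚ) eᵢⱼ ⟩
    c i j * edgeVec i j k         ≡⟨ cong₂ (λ a b → a * b * edgeVec i j k) (δ-diag i) (δ-diag j) ⟩
    1ℚ * 1ℚ * edgeVec i j k       ≡⟨ *-identityˡ _ ⟩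
    edgeVec i j k                 ∎

anyFin⁺ : ∀ {n} (p : Fin n → Bool) (i : Fin n) → p i ≡ true → anyFin p ≡ true
anyFin⁺ p zero    pᵢ rewrite pᵢ = refl
anyFin⁺ p (suc i) pᵢ with p zero
... | true  = refl
... | false = anyFin⁺ (λ k → p (suc k)) i pᵢ

anyFin⁻ : ∀ {n} (p : Fin n → Bool) → anyFin p ≡ true → ∃ λ i → p i ≡ true
anyFin⁻ {suc n} p any with p zero in p₀
... | true  = zero , p₀
... | false with anyFin⁻ (λ k → p (suc k)) any
...   | i , pᵢ = suc i , pᵢ

module _ {n} (E : Graph n) (S : Subset n) where

  N⁺ : ∀ {i j} → lookup S i ≡ true → E i j ≡ true → lookup (N E S) j ≡ true
  N⁺ {i} {j} i∈S eᵢⱼ =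
    trans (lookup∘tabulate _ j) (anyFin⁺ _ i (trans (cong (_∧ E i j) i∈S) eᵢⱼ))

  N⁻ : ∀ {j} → lookup (N E S) j ≡ true → ∃ λ i → lookup S i ≡ true × E i j ≡ true
  N⁻ {j} j∈NS with anyFin⁻ _ (trans (sym (lookup∘tabulate _ j)) j∈NS)
  ... | i , sᵢ∧eᵢⱼ = i , ∧-conicalˡ _ _ sᵢ∧eᵢⱼ , ∧-conicalʳ _ _ sᵢ∧eᵢⱼ

Reach-preserves : ∀ {n} {E : Graph n} (P : Fin n → Set) →
                  (∀ {v w} → E v w ≡ true → P v → P w) →
                  ∀ {v w} → Reach E v w → P v → P w
Reach-preserves P closed here       = λ pᵥ → pᵥ
Reach-preserves P closed (step e r) = Reach-preserves P closed r ∘ closed e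

lookup-⊆ : ∀ {n} {S T : Subset n} {i} → S ⊆ T → lookup S i ≡ true → lookup T i ≡ true
lookup-⊆ {S = S} {i = i} S⊆T i∈S = []=⇒lookup (S⊆T (lookup⇒[]= i S i∈S))

module Bipartite {n} {E : Graph n} {V1 : Subset n} (bip : IsBipartition E V1) where

  opposite-sides : ∀ {i j} → E i j ≡ true → lookup V1 j ≡ not (lookup V1 i)
  opposite-sides eᵢⱼ = ¬-not (≢-sym (bip _ _ eᵢⱼ))

  ∉-outside-V1 : ∀ {S} → S ⊆ V1 → ∀ {j} → lookup V1 j ≡ false → lookup S j ≡ false
  ∉-outside-V1 S⊆V1 j∉V1 = ¬-not λ j∈S → contradiction (trans (sym (lookup-⊆ S⊆V1 j∈S)) j∉V1) λ ()

  N-disjoint-V1 : ∀ {S} → S ⊆ V1 → ∀ {j} → lookup V1 j ≡ true → lookup (N E S) j ≡ false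
  N-disjoint-V1 {S} S⊆V1 j∈V1 = ¬-not λ j∈NS →
    let (i , i∈S , eᵢⱼ) = N⁻ E S j∈NS in bip i _ eᵢⱼ (trans (lookup-⊆ S⊆V1 i∈S) (sym j∈V1))

  module _ {S} (S⊆V1 : S ⊆ V1) {i j} (eᵢⱼ : E i j ≡ true) (i∈V1 : lookup V1 i ≡ true) where

    sumOver-edgeVec-S : sumOver S (edgeVec i j) ≡ 𝟙 (lookup S i)
    sumOver-edgeVec-S = begin
      sumOver S (edgeVec i j)          ≡⟨ sumOver-edgeVec S i j ⟩
      𝟙 (lookup S i) + 𝟙 (lookup S j)  ≡⟨ cong (λ b → 𝟙 (lookup S i) + 𝟙 b) j∉S ⟩
      𝟙 (lookup S i) + 0ℚ              ≡⟨ +-identityʳ _ ⟩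
      𝟙 (lookup S i)                   ∎
      where
      j∉S : lookup S j ≡ false
      j∉S = ∉-outside-V1 S⊆V1 (trans (opposite-sides eᵢⱼ) (cong not i∈V1))

    sumOver-edgeVec-N : sumOver (N E S) (edgeVec i j) ≡ 𝟙 (lookup (N E S) j)
    sumOver-edgeVec-N = begin
      sumOver (N E S) (edgeVec i j)
        ≡⟨ sumOver-edgeVec (N E S) i j ⟩
      𝟙 (lookup (N E S) i) + 𝟙 (lookup (N E S) j)
        ≡⟨ cong (λ b → 𝟙 b + 𝟙 (lookup (N E S) j)) (N-disjoint-V1 S⊆V1 i∈V1) ⟩
      0ℚ + 𝟙 (lookup (N E S) j)
        ≡⟨ +-identityˡ _ ⟩
      𝟙 (lookup (N E S) j) ∎

    edgeVec∈H⇔ : H E S (edgeVec i j) ⇔ (lookup S i ≡ lookup (N E S) j)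
    edgeVec∈H⇔ = mk⇔
      (λ h → 𝟙-injective (trans (sym sumOver-edgeVec-S) (trans h sumOver-edgeVec-N)))
      (λ agree → trans sumOver-edgeVec-S (trans (cong 𝟙 agree) (sym sumOver-edgeVec-N)))

  H-inclusion-on-edges : ∀ {S T} → S ⊆ V1 → T ⊆ V1 →
    (∀ x → EdgeCone E x → H E S x → H E T x) →
    ∀ {i j} → E i j ≡ true → lookup V1 i ≡ true →
    lookup S i ≡ lookup (N E S) j → lookup T i ≡ lookup (N E T) j
  H-inclusion-on-edges S⊆V1 T⊆V1 S→T eᵢⱼ i∈V1 =
    Equivalence.to (edgeVec∈H⇔ T⊆V1 eᵢⱼ i∈V1) ∘ S→T _ (edgeVec∈EdgeCone E eᵢⱼ) ∘
    Equivalence.from (edgeVec∈H⇔ S⊆V1 eᵢⱼ i∈V1)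

  module _ (simple : IsSimple E) {A B : Subset n} (A⊆V1 : A ⊆ V1) (B⊆V1 : B ⊆ V1)
           (A→B : ∀ x → EdgeCone E x → H E A x → H E B x)
           (B→A : ∀ x → EdgeCone E x → H E B x → H E A x) where

    Separating : Fin n → Set
    Separating v = (lookup V1 v ≡ true → lookup B v ≡ true × lookup A v ≡ false)
                 × (lookup V1 v ≡ false → lookup (N E A) v ≡ false × lookup (N E B) v ≡ true)

    separating-V1 : ∀ {v} → lookup V1 v ≡ true →
                    lookup B v ≡ true → lookup A v ≡ false → Separating v
    separating-V1 v∈V1 v∈B v∉A =
      (λ _ → v∈B , v∉A) , λ v∉V1 → contradiction (trans (sym v∈V1) v∉V1) λ ()

    separating-V2 : ∀ {v} → lookup V1 v ≡ false →
                    lookup (N E A) v ≡ false → lookup (N E B) v ≡ true → Separating v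
    separating-V2 v∉V1 v∉NA v∈NB =
      (λ v∈V1 → contradiction (trans (sym v∈V1) v∉V1) λ ()) , λ _ → v∉NA , v∈NB

    step-from-V1 : ∀ {v w} → E v w ≡ true → lookup V1 v ≡ true →
                   lookup B v ≡ true → lookup A v ≡ false → Separating w
    step-from-V1 {v} {w} v~w v∈V1 v∈B v∉A =
      separating-V2 (trans (opposite-sides v~w) (cong not v∈V1)) w∉NA w∈NB
      where
      w∈NB : lookup (N E B) w ≡ true
      w∈NB = N⁺ E B v∈B v~w
      w∉NA : lookup (N E A) w ≡ false
      w∉NA = trans (sym (H-inclusion-on-edges B⊆V1 A⊆V1 B→A v~w v∈V1 (trans v∈B (sym w∈NB)))) v∉A

    step-from-V2 : ∀ {v w} → E v w ≡ true → lookup V1 v ≡ false →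
                   lookup (N E A) v ≡ false → lookup (N E B) v ≡ true → Separating w
    step-from-V2 {v} {w} v~w v∉V1 v∉NA v∈NB = separating-V1 w∈V1 w∈B w∉A
      where
      w∈V1 : lookup V1 w ≡ true
      w∈V1 = trans (opposite-sides v~w) (cong not v∉V1)
      w~v : E w v ≡ true
      w~v = trans (proj₁ simple w v) v~w
      w∉A : lookup A w ≡ false
      w∉A = ¬-not λ w∈A → contradiction (trans (sym (N⁺ E A w∈A w~v)) v∉NA) λ ()
      w∈B : lookup B w ≡ true
      w∈B = trans (H-inclusion-on-edges A⊆V1 B⊆V1 A→B w~v w∈V1 (trans w∉A (sym v∉NA))) v∈NB

    separating-step : ∀ {v w} → E v w ≡ true → Separating v → Separating w
    separating-step {v} v~w (in-V1 , in-V2) with lookup V1 v in v∈V1?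
    ... | true  = uncurry (step-from-V1 v~w v∈V1?) (in-V1 refl)
    ... | false = uncurry (step-from-V2 v~w v∈V1?) (in-V2 refl)

    V1⊆B : IsConnected E → ∀ {k} → lookup B k ≡ true → lookup A k ≡ false →
           ∀ {v} → lookup V1 v ≡ true → lookup B v ≡ true
    V1⊆B conn {k} k∈B k∉A {v} v∈V1 =
      proj₁ (proj₁ (Reach-preserves Separating separating-step (conn k v)
                                    (separating-V1 (lookup-⊆ B⊆V1 k∈B) k∈B k∉A)) v∈V1)

    B⊆A : IsConnected E → B ⊂ V1 → B ⊆ A
    B⊆A conn (_ , x , x∈V1 , x∉B) {k} k∈B with lookup A k in k∈A?
    ... | true  = lookup⇒[]= k A k∈A?
    ... | false = contradiction (lookup⇒[]= x B (V1⊆B conn ([]=⇒lookup k∈B) k∈A? ([]=⇒lookup x∈V1))) x∉B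

lemma4p8 : (n : ℕ) (E : Graph n) (V1 : Subset n) →
           IsSimple E → IsConnected E → IsBipartition E V1 →
           (F : Vecℚ n → Set) → IsFacet (EdgeCone E) F →
           (A B : Subset n) → A ⊂ V1 → B ⊂ V1 →
           (∀ x → (F x → H E A x × EdgeCone E x) × (H E A x × EdgeCone E x → F x)) →
           (∀ x → (F x → H E B x × EdgeCone E x) × (H E B x × EdgeCone E x → F x)) →
           A ≡ B
lemma4p8 n E V1 simple conn bip F _ A B A⊂V1 B⊂V1 F≡A F≡B =
  ⊆-antisym (B⊆A simple (proj₁ B⊂V1) (proj₁ A⊂V1) B→A A→B conn A⊂V1)
            (B⊆A simple (proj₁ A⊂V1) (proj₁ B⊂V1) A→B B→A conn B⊂V1)
  where
  open Bipartite {E = E} {V1 = V1} bip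
  A→B : ∀ x → EdgeCone E x → H E A x → H E B x
  A→B x x∈C x∈H = proj₁ (proj₁ (F≡B x) (proj₂ (F≡A x) (x∈H , x∈C)))
  B→A : ∀ x → EdgeCone E x → H E B x → H E A x
  B→A x x∈C x∈H = proj₁ (proj₁ (F≡A x) (proj₂ (F≡B x) (x∈H , x∈C)))
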